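{- Let $H$ be a locally finite Borel $3$-uniform hypergraph with vertex set $V\subseteq\mathbb{N}^{\mathbb{N}}$ and hyperedge set $E\subseteq V^3$, let $\preceq$ be a Borel linear order on $\mathbb{N}^{\mathbb{N}}$, $E_{\mathrm{sort}}=\{(v_1,v_2,v_3)\in E: v_1\preceq v_2\preceq v_3\}$, and let $D(H)$ be the directed graph with vertex set $V\cup(E_{\mathrm{sort}}\times\{a',b',c'\})$ whose arcs are, for each $e=(v_1,v_2,v_3)\in E_{\mathrm{sort}}$, the images of the template arcs $a\to b,\ b\to c,\ a\to c,\ a'\to b',\ b'\to c',\ c'\to a',\ c'\to a,\ c\to a',\ b'\to a,\ b\to c',\ a'\to b,\ c\to b'$ under $a\mapsto v_1$, $b\mapsto v_2$, $c\mapsto v_3$, $t\mapsto(e,t)$ for $t\in\{a',b',c'\}$. If $D(H)$ admits a Borel $2$-dicoloring, then $H$ admits a Borel $2$-coloring.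
   Context: A Borel $2$-coloring of a $3$-uniform hypergraph is a Borel map $V\to\{0,1\}$ that is not constant on any hyperedge. A Borel $2$-dicoloring of a directed graph is a Borel map from its vertex set to $\{0,1\}$ such that each color class induces no directed cycle. The hypergraph is locally finite if every vertex lies in finitely many hyperedges. The labels $a',b',c'$ are three fixed distinct points. -}

module Defs where

open import Data.Nat using (ℕ; zero; suc)
open import Data.Bool using (Bool; true; false)
open import Data.Fin using (Fin)
open import Data.List using (List; []; _∷_)
open import Data.List.Membership.Propositional using (_∈_)
open import Data.Product using (Σ; _×_; _,_; proj₁; proj₂; ∃)
open import Data.Sum using (_⊎_; inj₁; inj₂)
open import Data.Unit using (⊤)
open import Relation.Nullary using (¬_)
open import Relation.Binary.PropositionalEquality using (_≡_)

Baire : Set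
Baire = ℕ → ℕ

Cyl : List ℕ → Baire → Set
Cyl []      x = ⊤
Cyl (n ∷ s) x = (x 0 ≡ n) × Cyl s (λ k → x (suc k))

-- Borel codes over a family of basic open sets indexed by B
data Code (B : Set) : Set where
  basic : B → Code B
  compl : Code B → Code B
  union : (ℕ → Code B) → Code B

⟦_⟧ : {X B : Set} → Code B → (B → X → Set) → X → Set
⟦ basic b ⟧ bas x = bas b x
⟦ compl c ⟧ bas x = ¬ ⟦ c ⟧ bas x
⟦ union f ⟧ bas x = Σ ℕ λ n → ⟦ f n ⟧ bas x

_⇔_ : Set → Set → Set
P ⇔ Q = (P → Q) × (Q → P)

Baire2 : Set
Baire2 = Baire × Baire

Triple : Set
Triple = Baire × Baire × Baire

basic1 : List ℕ → Baire → Set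
basic1 = Cyl

basic2 : List ℕ × List ℕ → Baire2 → Set
basic2 (s , t) (x , y) = Cyl s x × Cyl t y

basic3 : List ℕ × List ℕ × List ℕ → Triple → Set
basic3 (s , t , u) (x , y , z) = Cyl s x × Cyl t y × Cyl u z

BorelSet1 : (Baire → Set) → Set
BorelSet1 A = Σ (Code (List ℕ)) λ c → ∀ x → A x ⇔ ⟦ c ⟧ basic1 x

BorelSet2 : (Baire2 → Set) → Set
BorelSet2 A = Σ (Code (List ℕ × List ℕ)) λ c → ∀ p → A p ⇔ ⟦ c ⟧ basic2 p

BorelSet3 : (Triple → Set) → Set
BorelSet3 A = Σ (Code (List ℕ × List ℕ × List ℕ)) λ c → ∀ e → A e ⇔ ⟦ c ⟧ basic3 e

-- f restricted to the (Borel) subset V is a Borel map V → {0,1}: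
-- f⁻¹(true) ∩ V is relatively Borel in V.
BorelMapOn1 : (Baire → Set) → (Baire → Bool) → Set
BorelMapOn1 V f = Σ (Code (List ℕ)) λ c → ∀ x → V x → (f x ≡ true) ⇔ ⟦ c ⟧ basic1 x

BorelMapOn3 : (Triple → Set) → (Triple → Bool) → Set
BorelMapOn3 V f = Σ (Code (List ℕ × List ℕ × List ℕ)) λ c →
  ∀ e → V e → (f e ≡ true) ⇔ ⟦ c ⟧ basic3 e

π₁ π₂ π₃ : Triple → Baire
π₁ (x , y , z) = x
π₂ (x , y , z) = y
π₃ (x , y , z) = z

record Borel3Hypergraph : Set₁ where
  field
    V : Baire → Set
    E : Triple → Set
    V-Borel : BorelSet1 V
    E-Borel : BorelSet3 E
    E⊆V³ : ∀ e → E e → V (π₁ e) × V (π₂ e) × V (π₃ e)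
    -- 3-uniform: the three vertices of a hyperedge are distinct
    E-distinct : ∀ e → E e →
      ¬ (π₁ e ≡ π₂ e) × ¬ (π₂ e ≡ π₃ e) × ¬ (π₁ e ≡ π₃ e)
    -- hyperedges are unordered: E is closed under permutations
    -- (generated by the transpositions (12) and (23))
    E-swap12 : ∀ x y z → E (x , y , z) → E (y , x , z)
    E-swap23 : ∀ x y z → E (x , y , z) → E (x , z , y)

open Borel3Hypergraph public

LocallyFinite : Borel3Hypergraph → Set
LocallyFinite H = ∀ x → V H x → Σ (List Triple) λ L →
  ∀ e → E H e → (x ≡ π₁ e ⊎ x ≡ π₂ e ⊎ x ≡ π₃ e) → e ∈ L

Borel2Coloring : Borel3Hypergraph → (Baire → Bool) → Set
Borel2Coloring H f = BorelMapOn1 (V H) f ×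
  (∀ e → E H e → ¬ ((f (π₁ e) ≡ f (π₂ e)) × (f (π₂ e) ≡ f (π₃ e))))

record BorelLinearOrder (_≼_ : Baire → Baire → Set) : Set where
  field
    borel   : BorelSet2 (λ p → proj₁ p ≼ proj₂ p)
    refl≼   : ∀ x → x ≼ x
    antisym : ∀ x y → x ≼ y → y ≼ x → x ≡ y
    trans≼  : ∀ x y z → x ≼ y → y ≼ z → x ≼ z
    total   : ∀ x y → (x ≼ y) ⊎ (y ≼ x)

Esort : Borel3Hypergraph → (Baire → Baire → Set) → Triple → Set
Esort H _≼_ e = E H e × (π₁ e ≼ π₂ e) × (π₂ e ≼ π₃ e)

data Label : Set where
  a′ b′ c′ : Label

DVertex : Set
DVertex = Baire ⊎ (Triple × Label)

data T : Set where
  a b c ta′ tb′ tc′ : T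

embed : Triple → T → DVertex
embed e a   = inj₁ (π₁ e)
embed e b   = inj₁ (π₂ e)
embed e c   = inj₁ (π₃ e)
embed e ta′ = inj₂ (e , a′)
embed e tb′ = inj₂ (e , b′)
embed e tc′ = inj₂ (e , c′)

data TArc : T → T → Set where
  ab     : TArc a b
  bc     : TArc b c
  ac     : TArc a c
  a′b′   : TArc ta′ tb′
  b′c′   : TArc tb′ tc′
  c′a′   : TArc tc′ ta′
  c′a    : TArc tc′ a
  ca′    : TArc c ta′
  b′a    : TArc tb′ a
  bc′    : TArc b tc′
  a′b    : TArc ta′ b
  cb′    : TArc c tb′

IsDVertex : Borel3Hypergraph → (Baire → Baire → Set) → DVertex → Set
IsDVertex H _≼_ (inj₁ x)       = V H x
IsDVertex H _≼_ (inj₂ (e , t)) = Esort H _≼_ e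

Arc : Borel3Hypergraph → (Baire → Baire → Set) → DVertex → DVertex → Set
Arc H _≼_ u w = Σ Triple λ e → Esort H _≼_ e × Σ T λ i → Σ T λ j →
  TArc i j × (u ≡ embed e i) × (w ≡ embed e j)

data Walk (H : Borel3Hypergraph) (_≼_ : Baire → Baire → Set)
          (col : DVertex → Bool) (k : Bool) : DVertex → DVertex → Set where
  one  : ∀ {u w} → col u ≡ k → col w ≡ k → Arc H _≼_ u w → Walk H _≼_ col k u w
  step : ∀ {u v w} → col u ≡ k → Arc H _≼_ u v → Walk H _≼_ col k v w →
         Walk H _≼_ col k u w

-- Borel 2-dicoloring of D(H): Borel (w.r.t. the standard Borel structure of
-- V ⊔ (Esort × {a',b',c'})) and no colour class contains a directed cycle.
Borel2Dicoloring : Borel3Hypergraph → (Baire → Baire → Set) → (DVertex → Bool) → Set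
Borel2Dicoloring H _≼_ col =
  BorelMapOn1 (V H) (λ x → col (inj₁ x)) ×
  (∀ t → BorelMapOn3 (Esort H _≼_) (λ e → col (inj₂ (e , t)))) ×
  (∀ k u → IsDVertex H _≼_ u → ¬ Walk H _≼_ col k u u)

-- A hyperedge e that is monochromatic under the restriction f of a dicolouring
-- of D(H) to V yields a monochromatic directed triangle in the gadget of (the
-- sorted copy of) e: if one of the gadget vertices a', b', c' has the colour
-- of e, it closes a triangle with two of a, b, c; otherwise a' → b' → c' → a'
-- is monochromatic.
module Submission where

open import Defs
open import Data.Bool using (Bool)
open import Data.Bool.Properties using (_≟_; ¬-not)
open import Data.Empty using (⊥)
open import Data.Product using (Σ; _×_; _,_)
open import Data.Sum using (_⊎_; inj₁; inj₂)
open import Function using (_∘_)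
open import Relation.Nullary using (¬_; yes; no)
open import Relation.Binary.PropositionalEquality using (_≡_; refl; sym; trans)

≡-or-all-≡ : ∀ k x y z → x ≡ k ⊎ y ≡ k ⊎ z ≡ k ⊎ (x ≡ y × y ≡ z)
≡-or-all-≡ k x y z with x ≟ k | y ≟ k | z ≟ k
... | yes x≡k | _       | _       = inj₁ x≡k
... | no _    | yes y≡k | _       = inj₂ (inj₁ y≡k)
... | no _    | no _    | yes z≡k = inj₂ (inj₂ (inj₁ z≡k))
... | no x≢k  | no y≢k  | no z≢k  = inj₂ (inj₂ (inj₂
  (trans (¬-not x≢k) (sym (¬-not y≢k)) , trans (¬-not y≢k) (sym (¬-not z≢k)))))

Monochromatic : (Baire → Bool) → Triple → Set
Monochromatic f e = (f (π₁ e) ≡ f (π₂ e)) × (f (π₂ e) ≡ f (π₃ e))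

¬Monochromatic-swap12 : ∀ f x y z → ¬ Monochromatic f (y , x , z) → ¬ Monochromatic f (x , y , z)
¬Monochromatic-swap12 f x y z ¬m (p , q) = ¬m (sym p , trans p q)

¬Monochromatic-swap23 : ∀ f x y z → ¬ Monochromatic f (x , z , y) → ¬ Monochromatic f (x , y , z)
¬Monochromatic-swap23 f x y z ¬m (p , q) = ¬m (trans p q , sym q)

module _ (H : Borel3Hypergraph) {_≼_ : Baire → Baire → Set}
         (total : ∀ x y → (x ≼ y) ⊎ (y ≼ x)) where

  sorted-suffices : (P : Triple → Set) →
    (∀ x y z → P (y , x , z) → P (x , y , z)) →
    (∀ x y z → P (x , z , y) → P (x , y , z)) →
    (∀ e → Esort H _≼_ e → P e) → ∀ e → E H e → P e
  sorted-suffices P P-swap12 P-swap23 P-sorted (x , y , z) exyz =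
    by-order (total x y) (total y z) (total x z)
    where
    exzy = E-swap23 H x y z exyz
    eyxz = E-swap12 H x y z exyz
    ezxy = E-swap12 H x z y exzy
    eyzx = E-swap23 H y x z eyxz
    ezyx = E-swap12 H y z x eyzx

    by-order : (x ≼ y) ⊎ (y ≼ x) → (y ≼ z) ⊎ (z ≼ y) → (x ≼ z) ⊎ (z ≼ x) → P (x , y , z)
    by-order (inj₁ x≼y) (inj₁ y≼z) _ = P-sorted _ (exyz , x≼y , y≼z)
    by-order (inj₁ x≼y) (inj₂ z≼y) (inj₁ x≼z) =
      P-swap23 x y z (P-sorted _ (exzy , x≼z , z≼y))
    by-order (inj₁ x≼y) (inj₂ z≼y) (inj₂ z≼x) =
      P-swap23 x y z (P-swap12 x z y (P-sorted _ (ezxy , z≼x , x≼y)))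
    by-order (inj₂ y≼x) (inj₁ y≼z) (inj₁ x≼z) =
      P-swap12 x y z (P-sorted _ (eyxz , y≼x , x≼z))
    by-order (inj₂ y≼x) (inj₁ y≼z) (inj₂ z≼x) =
      P-swap12 x y z (P-swap23 y x z (P-sorted _ (eyzx , y≼z , z≼x)))
    by-order (inj₂ y≼x) (inj₂ z≼y) _ =
      P-swap12 x y z (P-swap23 y x z (P-swap12 y z x (P-sorted _ (ezyx , z≼y , y≼x))))

module _ (H : Borel3Hypergraph) (_≼_ : Baire → Baire → Set) (col : DVertex → Bool)
         (acyclic : ∀ k u → IsDVertex H _≼_ u → ¬ Walk H _≼_ col k u u) where

  no-monochromatic-triangle : ∀ {k u v w} →
    Arc H _≼_ u v → Arc H _≼_ v w → Arc H _≼_ w u → IsDVertex H _≼_ u →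
    col u ≡ k → col v ≡ k → col w ≡ k → ⊥
  no-monochromatic-triangle uv vw wu u∈D u≡k v≡k w≡k =
    acyclic _ _ u∈D (step u≡k uv (step v≡k vw (one w≡k u≡k wu)))

  gadget-arc : ∀ {e} → Esort H _≼_ e → ∀ {i j} → TArc i j → Arc H _≼_ (embed e i) (embed e j)
  gadget-arc {e} es {i} {j} ij = e , es , i , j , ij , refl , refl

  sorted-not-monochromatic : ∀ e → Esort H _≼_ e → ¬ Monochromatic (col ∘ inj₁) e
  sorted-not-monochromatic e es (ab≡ , bc≡) =
    by-labels (≡-or-all-≡ (col (embed e a)) (col (embed e ta′)) (col (embed e tb′)) (col (embed e tc′)))
    where
    arc = gadget-arc es
    b≡k = sym ab≡
    c≡k = sym (trans ab≡ bc≡)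

    by-labels : let k = col (embed e a) in
      col (embed e ta′) ≡ k ⊎ col (embed e tb′) ≡ k ⊎ col (embed e tc′) ≡ k ⊎
      (col (embed e ta′) ≡ col (embed e tb′) × col (embed e tb′) ≡ col (embed e tc′)) → ⊥
    by-labels (inj₁ a′≡k) =
      no-monochromatic-triangle (arc a′b) (arc bc) (arc ca′) es a′≡k b≡k c≡k
    by-labels (inj₂ (inj₁ b′≡k)) =
      no-monochromatic-triangle (arc b′a) (arc ac) (arc cb′) es b′≡k refl c≡k
    by-labels (inj₂ (inj₂ (inj₁ c′≡k))) =
      no-monochromatic-triangle (arc c′a) (arc ab) (arc bc′) es c′≡k refl b≡k
    by-labels (inj₂ (inj₂ (inj₂ (a′≡b′ , b′≡c′)))) =
      no-monochromatic-triangle (arc a′b′) (arc b′c′) (arc c′a′) es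
        refl (sym a′≡b′) (sym (trans a′≡b′ b′≡c′))

claim4p4 : (H : Borel3Hypergraph) → LocallyFinite H →
    (_≼_ : Baire → Baire → Set) → BorelLinearOrder _≼_ →
    Σ (DVertex → Bool) (λ col → Borel2Dicoloring H _≼_ col) →
    Σ (Baire → Bool) (λ f → Borel2Coloring H f)
claim4p4 H _ _≼_ order (col , col-Borel , _ , acyclic) =
  col ∘ inj₁ , col-Borel , sorted-suffices H (BorelLinearOrder.total order)
    (λ e → ¬ Monochromatic (col ∘ inj₁) e)
    (¬Monochromatic-swap12 (col ∘ inj₁)) (¬Monochromatic-swap23 (col ∘ inj₁))
    (sorted-not-monochromatic H _≼_ col acyclic)
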